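{- Let $\Pi$ be a mini-gringo program. For either version of ordered completion (the predicate version or the level-mapping version), the ordered completion $\mathrm{OC}(\Pi)$ is logically equivalent to the simplified ordered completion $\mathrm{OC}_s(\Pi)$.
   Context: Mini-gringo programs: program terms are numerals $\overline n$, symbolic constants, program variables, $\mathit{inf}$, $\mathit{sup}$, $|t|$ and $(t_1\circ t_2)$ with $\circ\in\{+,-,\times,/,\backslash,..\}$. An atom is $p(\mathbf t)$; a literal is an atom preceded by zero, one or two $\mathit{not}$; a comparison is $t_1\prec t_2$ with $\prec\in\{=,\neq,<,>,\le,\ge\}$. A rule is $\mathit{Head}\leftarrow\mathit{Body}$, $\mathit{Body}$ a possibly empty conjunction $B_1\wedge\dots\wedge B_n$ of literals and comparisons, $\mathit{Head}$ an atom $p(\mathbf t)$ (basic rule), $\{p(\mathbf t)\}$ (choice rule) or empty (constraint); a program is a finite set of rules; $\mathcal L(\Pi)$ is the set of its predicates. For a rule $R$: $\mathrm{Body}(R)$ its body; $B^+(R)$ the set of un-negated atoms of its body; $\mathrm{HeadLit}(R)=p(\mathbf t)$ if the head is $p(\mathbf t)$ or $\{p(\mathbf t)\}$. Formulas are in a two-sorted first-order language (sorts general and its subsort integer) with arithmetic $|\cdot|,+,-,\times$ on integers and comparisons. $\mathrm{val}_t(V)$: $V=t$ if $t$ is precomputed or a variable; $\exists I(\mathrm{val}_{t_1}(I)\wedge V=|I|)$ for $|t_1|$; $\exists I,J(\mathrm{val}_{t_1}(I)\wedge\mathrm{val}_{t_2}(J)\wedge V=I\circ J)$ for $\circ\in\{+,-,\times\}$;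 for $t_1/t_2$: $\exists I,J,K(\mathrm{val}_{t_1}(I)\wedge\mathrm{val}_{t_2}(J)\wedge K\times|J|\le|I|<(K+\overline1)\times|J|\wedge((I\times J\ge\overline0\wedge V=K)\vee(I\times J<\overline0\wedge V=-K)))$; for $t_1\backslash t_2$ the same with $V=I-K\times J$ and $V=I+K\times J$; for $t_1..t_2$: $\exists I,J,K(\mathrm{val}_{t_1}(I)\wedge\mathrm{val}_{t_2}(J)\wedge I\le K\le J\wedge V=K)$; $I,J,K$ fresh integer variables; tuples give conjunctions. $\tau^B(q(\mathbf t))=\exists\mathbf V(\mathrm{val}_{\mathbf t}(\mathbf V)\wedge q(\mathbf V))$; $\tau^B(\mathit{not}\,q(\mathbf t))$, $\tau^B(\mathit{not}\,\mathit{not}\,q(\mathbf t))$ likewise with $\neg q(\mathbf V)$, $\neg\neg q(\mathbf V)$; $\tau^B(t_1\prec t_2)=\exists V_1V_2(\mathrm{val}_{t_1}(V_1)\wedge\mathrm{val}_{t_2}(V_2)\wedge V_1\prec V_2)$; $\tau^B$ of a conjunction is the conjunction of the $\tau^B(B_i)$. Versions. Predicate version: for each pair of predicates $p,q$ a new predicate $<_{pq}$ of arity $\mathrm{ar}(p)+\mathrm{ar}(q)$; $\mathrm{Ord}(q(\mathbf Z),p(\mathbf X))$ is $\mathbf Z<_{qp}\mathbf X$; $\mathrm{Axioms}(\Pi)=\mathrm{Irref}(\Pi)\wedge\mathrm{Trans}(\Pi)$ with $\mathrm{Irref}(\Pi)=\bigwedge_{p\in\mathcal L(\Pi)}\forall\mathbf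 X\neg(\mathbf X<_{pp}\mathbf X)$ and $\mathrm{Trans}(\Pi)=\bigwedge_{p,q,r\in\mathcal L(\Pi)}\forall\mathbf X\mathbf Y\mathbf Z(\mathbf X<_{pq}\mathbf Y\wedge\mathbf Y<_{qr}\mathbf Z\to\mathbf X<_{pr}\mathbf Z)$. Level-mapping version: for each predicate $p/n$ a new $n$-ary integer-valued function $\mathrm{lvl}_p$; $\mathrm{Ord}(q(\mathbf Z),p(\mathbf X))$ is $\mathrm{lvl}_q(\mathbf Z)<\mathrm{lvl}_p(\mathbf X)$; $\mathrm{Axioms}(\Pi)=\bigwedge_{p\in\mathcal L(\Pi)}\forall\mathbf X(\mathrm{lvl}_p(\mathbf X)\ge\overline0)$. For a basic or choice rule $R$ with head atom $p(\mathbf t)$ and fresh program variables $\mathbf X$: $\mathrm{Form}(R,\mathbf X)=\mathrm{val}_{\mathbf t}(\mathbf X)\wedge\tau^B(\mathrm{Body}(R))$ (basic) resp. with additional conjunct $\neg\neg p(\mathbf X)$ (choice); $\mathrm{OForm}(R,\mathbf X)$ is the same with $\tau^B_<$ in place of $\tau^B$, where $\tau^B_<$ acts conjunct-wise, $\tau^B_<(q(\mathbf t))=\exists\mathbf V(\mathrm{val}_{\mathbf t}(\mathbf V)\wedge q(\mathbf V)\wedge\mathrm{Ord}(q(\mathbf V),p(\mathbf X)))$ for atoms and $\tau^B_<(B_i)=\tau^B(B_i)$ otherwise. With $\mathbf Y$ the free variables of $\mathrm{Form}(R,\mathbf X)$ other than $\mathbf X$ and $\mathbf Z$ fresh: $\mathrm{Comp}^{\leftarrow}(p)=\forall\mathbf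 X\big(\bigvee_{R\in\Pi,\mathrm{HeadLit}(R)=p(\mathbf t)}\exists\mathbf Y\,\mathrm{Form}(R,\mathbf X)\to p(\mathbf X)\big)$; $\mathrm{OComp}^{\to}(p)=\forall\mathbf X\big(p(\mathbf X)\to\bigvee_{R\in\Pi,\mathrm{HeadLit}(R)=p(\mathbf t)}\exists\mathbf Y(\mathrm{Form}(R,\mathbf X)\wedge\bigwedge_{q(\mathbf t')\in B^+(R)}\exists\mathbf Z(\mathrm{val}_{\mathbf t'}(\mathbf Z)\wedge q(\mathbf Z)\wedge\mathrm{Ord}(q(\mathbf Z),p(\mathbf X))))\big)$; $\mathrm{OComp}_s^{\to}(p)=\forall\mathbf X\big(p(\mathbf X)\to\bigvee_{R\in\Pi,\mathrm{HeadLit}(R)=p(\mathbf t)}\exists\mathbf Y\,\mathrm{OForm}(R,\mathbf X)\big)$. $\mathrm{Cons}(\Pi)=\bigwedge_{R\text{ constraint in }\Pi}\forall\mathbf U\neg\tau^B(\mathrm{Body}(R))$ ($\mathbf U$ its free variables). $\mathrm{OC}(\Pi)=\mathrm{Cons}(\Pi)\wedge\mathrm{Axioms}(\Pi)\wedge\bigwedge_{p\in\mathcal L(\Pi)}(\mathrm{Comp}^{\leftarrow}(p)\wedge\mathrm{OComp}^{\to}(p))$ and $\mathrm{OC}_s(\Pi)=\mathrm{Cons}(\Pi)\wedge\mathrm{Axioms}(\Pi)\wedge\bigwedge_{p\in\mathcal L(\Pi)}(\mathrm{Comp}^{\leftarrow}(p)\wedge\mathrm{OComp}_s^{\to}(p))$.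 -}

module Defs where

open import Data.Nat using (ℕ)
import Data.Nat as ℕ
open import Data.Integer using (ℤ; 0ℤ; 1ℤ)
open import Data.Product using (_×_; _,_; proj₁; proj₂; Σ)
open import Data.Product.Properties using (≡-dec)
open import Data.List using (List; []; _∷_; _++_; concatMap)
open import Data.List.Membership.Propositional using (_∈_)
open import Data.Vec using (Vec; []; _∷_)
open import Data.Unit using (⊤)
open import Data.Empty using (⊥)
open import Relation.Nullary using (¬_; yes; no)
open import Relation.Binary.PropositionalEquality using (_≡_; refl)
open import Relation.Binary.Definitions using (DecidableEquality)

-- A predicate symbol p/n is a pair (name , arity).
Pred : Set
Pred = ℕ × ℕ

ar : Pred → ℕ
ar = proj₂

_≟P_ : DecidableEquality Pred
_≟P_ = ≡-dec ℕ._≟_ ℕ._≟_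

data BinOp : Set where
  plus minus times div mod dots : BinOp

data Term : Set where
  num : ℤ → Term
  sym : ℕ → Term
  var : ℕ → Term
  inf sup : Term
  abs : Term → Term
  bin : BinOp → Term → Term → Term

data CmpRel : Set where
  eq neq lt gt le ge : CmpRel

record Atom : Set where
  constructor _⦅_⦆
  field
    pred : Pred
    args : Vec Term (ar pred)

-- zero, one or two 'not'
data Sign : Set where
  pos not1 not2 : Sign

data BodyElem : Set where
  lit : Sign → Atom → BodyElem
  cmp : CmpRel → Term → Term → BodyElem

data Head : Set where
  basic  : Atom → Head
  choice : Atom → Head
  empty  : Head             -- constraint

record Rule : Set where
  constructor _⟵_
  field
    head : Head
    body : List BodyElem
open Rule public

Program : Set
Program = List Rule

bodyPreds : List BodyElem → List Pred
bodyPreds [] = []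
bodyPreds (lit s a ∷ bs) = Atom.pred a ∷ bodyPreds bs
bodyPreds (cmp _ _ _ ∷ bs) = bodyPreds bs

headPreds : Head → List Pred
headPreds (basic a) = Atom.pred a ∷ []
headPreds (choice a) = Atom.pred a ∷ []
headPreds empty = []

𝓛 : Program → List Pred
𝓛 = concatMap (λ R → headPreds (head R) ++ bodyPreds (body R))

posAtoms : List BodyElem → List Atom
posAtoms [] = []
posAtoms (lit pos a ∷ bs) = a ∷ posAtoms bs
posAtoms (lit not1 a ∷ bs) = posAtoms bs
posAtoms (lit not2 a ∷ bs) = posAtoms bs
posAtoms (cmp _ _ _ ∷ bs) = posAtoms bs

-- Interpretations of the two-sorted language (arbitrary, not only
-- standard ones), including the symbols of both versions:
-- the predicates <_pq and the functions lvl_p.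

record Interp : Set₁ where
  field
    G      : Set
    Z      : Set
    ι      : Z → G               -- integer sort is a subsort of general
    ι-inj  : ∀ {a b} → ι a ≡ ι b → a ≡ b
    numI   : ℤ → Z
    symI   : ℕ → G
    infI supI : G
    absI negI : Z → Z
    plusI minusI timesI : Z → Z → Z
    ltI gtI leI geI : G → G → Set  -- comparison symbols (= is equality, ≠ is ¬ =)
    predI  : (p : Pred) → Vec G (ar p) → Set
    ordI   : (p q : Pred) → Vec G (ar p) → Vec G (ar q) → Set
    lvlI   : (p : Pred) → Vec G (ar p) → Z

-- Classical (Gödel–Gentzen negative translation) connectives, so that
-- satisfaction below coincides with classical Tarskian truth.

At : Set → Set
At P = ¬ ¬ P

∃c : {A : Set} → (A → Set) → Set
∃c {A} B = ¬ ((x : A) → ¬ B x)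

_∨c_ : Set → Set → Set
A ∨c B = ¬ (¬ A × ¬ B)

infixr 1 _∨c_

data Version : Set where
  predicateVersion levelVersion : Version

module Sem (I : Interp) where
  open Interp I

  Env : Set
  Env = ℕ → G

  _≐_ : G → G → Set
  v ≐ w = At (v ≡ w)

  zeroI oneI : Z
  zeroI = numI 0ℤ
  oneI = numI 1ℤ

  rel : CmpRel → G → G → Set
  rel eq a b = At (a ≡ b)
  rel neq a b = ¬ At (a ≡ b)
  rel lt a b = At (ltI a b)
  rel gt a b = At (gtI a b)
  rel le a b = At (leI a b)
  rel ge a b = At (geI a b)

  valBin : BinOp → (G → Set) → (G → Set) → G → Set
  valBin plus  v1 v2 v = ∃c λ i → ∃c λ j → v1 (ι i) × v2 (ι j) × v ≐ ι (plusI i j)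
  valBin minus v1 v2 v = ∃c λ i → ∃c λ j → v1 (ι i) × v2 (ι j) × v ≐ ι (minusI i j)
  valBin times v1 v2 v = ∃c λ i → ∃c λ j → v1 (ι i) × v2 (ι j) × v ≐ ι (timesI i j)
  valBin div   v1 v2 v = ∃c λ i → ∃c λ j → ∃c λ k →
      v1 (ι i) × v2 (ι j)
    × At (leI (ι (timesI k (absI j))) (ι (absI i)))
    × At (ltI (ι (absI i)) (ι (timesI (plusI k oneI) (absI j))))
    × ((At (geI (ι (timesI i j)) (ι zeroI)) × v ≐ ι k)
       ∨c (At (ltI (ι (timesI i j)) (ι zeroI)) × v ≐ ι (negI k)))
  valBin mod   v1 v2 v = ∃c λ i → ∃c λ j → ∃c λ k →
      v1 (ι i) × v2 (ι j)
    × At (leI (ι (timesI k (absI j))) (ι (absI i)))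
    × At (ltI (ι (absI i)) (ι (timesI (plusI k oneI) (absI j))))
    × ((At (geI (ι (timesI i j)) (ι zeroI)) × v ≐ ι (minusI i (timesI k j)))
       ∨c (At (ltI (ι (timesI i j)) (ι zeroI)) × v ≐ ι (plusI i (timesI k j))))
  valBin dots  v1 v2 v = ∃c λ i → ∃c λ j → ∃c λ k →
      v1 (ι i) × v2 (ι j) × At (leI (ι i) (ι k)) × At (leI (ι k) (ι j)) × v ≐ ι k

  val : Env → Term → G → Set
  val ρ (num n) v = v ≐ ι (numI n)
  val ρ (sym c) v = v ≐ symI c
  val ρ (var x) v = v ≐ ρ x
  val ρ inf v = v ≐ infI
  val ρ sup v = v ≐ supI
  val ρ (abs t) v = ∃c λ i → val ρ t (ι i) × v ≐ ι (absI i)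
  val ρ (bin o t₁ t₂) v = valBin o (val ρ t₁) (val ρ t₂) v

  valV : ∀ {n} → Env → Vec Term n → Vec G n → Set
  valV ρ [] [] = ⊤
  valV ρ (t ∷ ts) (v ∷ vs) = val ρ t v × valV ρ ts vs

  τB : Env → BodyElem → Set
  τB ρ (lit pos  (q ⦅ ts ⦆)) = ∃c λ V → valV ρ ts V × At (predI q V)
  τB ρ (lit not1 (q ⦅ ts ⦆)) = ∃c λ V → valV ρ ts V × ¬ At (predI q V)
  τB ρ (lit not2 (q ⦅ ts ⦆)) = ∃c λ V → valV ρ ts V × ¬ ¬ At (predI q V)
  τB ρ (cmp r t₁ t₂) = ∃c λ v₁ → ∃c λ v₂ → val ρ t₁ v₁ × val ρ t₂ v₂ × rel r v₁ v₂

  τBody : Env → List BodyElem → Set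
  τBody ρ [] = ⊤
  τBody ρ (b ∷ bs) = τB ρ b × τBody ρ bs

  Ord : Version → (q : Pred) → Vec G (ar q) → (p : Pred) → Vec G (ar p) → Set
  Ord predicateVersion q Zs p X = At (ordI q p Zs X)
  Ord levelVersion q Zs p X = At (ltI (ι (lvlI q Zs)) (ι (lvlI p X)))

  τB< : Version → (p : Pred) → Vec G (ar p) → Env → BodyElem → Set
  τB< v p X ρ (lit pos (q ⦅ ts ⦆)) =
    ∃c λ V → valV ρ ts V × At (predI q V) × Ord v q V p X
  τB< v p X ρ b = τB ρ b

  τBody< : Version → (p : Pred) → Vec G (ar p) → Env → List BodyElem → Set
  τBody< v p X ρ [] = ⊤
  τBody< v p X ρ (b ∷ bs) = τB< v p X ρ b × τBody< v p X ρ bs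

  -- Form with a given body translation; ⊥ if the head predicate is not p
  -- (so that disjunctions over all rules are disjunctions over the rules
  -- with HeadLit(R) = p(t)).
  formWith : (Env → Set) → Head → (p : Pred) → Vec G (ar p) → Env → Set
  formWith B (basic (q ⦅ ts ⦆)) p X ρ with q ≟P p
  ... | yes refl = valV ρ ts X × B ρ
  ... | no _ = ⊥
  formWith B (choice (q ⦅ ts ⦆)) p X ρ with q ≟P p
  ... | yes refl = valV ρ ts X × B ρ × ¬ ¬ At (predI p X)
  ... | no _ = ⊥
  formWith B empty p X ρ = ⊥

  Form : Rule → (p : Pred) → Vec G (ar p) → Env → Set
  Form R p X = formWith (λ ρ → τBody ρ (body R)) (head R) p X

  OForm : Version → Rule → (p : Pred) → Vec G (ar p) → Env → Set
  OForm v R p X = formWith (λ ρ → τBody< v p X ρ (body R)) (head R) p X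

  PosOrd : Version → List Atom → (p : Pred) → Vec G (ar p) → Env → Set
  PosOrd v [] p X ρ = ⊤
  PosOrd v ((q ⦅ ts ⦆) ∷ as) p X ρ =
    (∃c λ Zs → valV ρ ts Zs × At (predI q Zs) × Ord v q Zs p X) × PosOrd v as p X ρ

  ⋁R : Program → (Rule → Set) → Set
  ⋁R [] F = ⊥
  ⋁R (R ∷ Rs) F = F R ∨c ⋁R Rs F

  Comp← : Program → Pred → Set
  Comp← Π p = ∀ X → ⋁R Π (λ R → ∃c λ ρ → Form R p X ρ) → At (predI p X)

  OComp→ : Version → Program → Pred → Set
  OComp→ v Π p = ∀ X → At (predI p X) →
    ⋁R Π (λ R → ∃c λ ρ → Form R p X ρ × PosOrd v (posAtoms (body R)) p X ρ)

  OComps→ : Version → Program → Pred → Set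
  OComps→ v Π p = ∀ X → At (predI p X) → ⋁R Π (λ R → ∃c λ ρ → OForm v R p X ρ)

  consRule : Rule → Set
  consRule (empty ⟵ bs) = ∀ ρ → ¬ τBody ρ bs
  consRule (basic _ ⟵ _) = ⊤
  consRule (choice _ ⟵ _) = ⊤

  Cons : Program → Set
  Cons [] = ⊤
  Cons (R ∷ Rs) = consRule R × Cons Rs

  Axioms : Version → Program → Set
  Axioms predicateVersion Π =
      (∀ p → p ∈ 𝓛 Π → ∀ X → ¬ At (ordI p p X X))
    × (∀ p q r → p ∈ 𝓛 Π → q ∈ 𝓛 Π → r ∈ 𝓛 Π → ∀ X Y W →
         At (ordI p q X Y) × At (ordI q r Y W) → At (ordI p r X W))
  Axioms levelVersion Π =
    ∀ p → p ∈ 𝓛 Π → ∀ X → At (geI (ι (lvlI p X)) (ι zeroI))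

  OC : Version → Program → Set
  OC v Π = Cons Π × Axioms v Π × (∀ p → p ∈ 𝓛 Π → Comp← Π p × OComp→ v Π p)

  OCs : Version → Program → Set
  OCs v Π = Cons Π × Axioms v Π × (∀ p → p ∈ 𝓛 Π → Comp← Π p × OComps→ v Π p)

{-# OPTIONS --safe #-}
-- OC and OC_s share Cons, Axioms and Comp←, so only OComp→ matters, and there rule by
-- rule: τ^B_< attaches Ord(q(V), p(X)) to each positive body atom, while OComp→ keeps
-- the plain body τ^B and lists the same ordered atoms separately, one per element of
-- B⁺(R).  An ordered atom implies its plain one, so the two rule bodies are equivalent.
module Submission where

open import Defs
open import Function.Base using (_∘_)
open import Function.Bundles using (_⇔_; mk⇔; Equivalence)
open import Data.Product using (_×_; _,_; proj₁; map₂)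
open import Data.List using ([]; _∷_)
open import Data.Vec using (Vec)
open import Data.Unit using (tt)
open import Data.Empty using (⊥-elim)
open import Relation.Nullary using (yes; no)
open import Relation.Binary.PropositionalEquality using (refl)

open Equivalence using (to; from)

∃c-map : {A : Set} {B C : A → Set} → (∀ x → B x → C x) → ∃c B → ∃c C
∃c-map f ∃B ∀¬C = ∃B λ x b → ∀¬C x (f x b)

∨c-map : {A B C D : Set} → (A → C) → (B → D) → A ∨c B → C ∨c D
∨c-map f g a∨b (¬c , ¬d) = a∨b (¬c ∘ f , ¬d ∘ g)

×-assocʳ-cong : {A B C D : Set} → (B × C) ⇔ D → ((A × B) × C) ⇔ (A × D)
×-assocʳ-cong e = mk⇔ (λ ((a , b) , c) → a , to e (b , c))
                      (λ (a , d) → let (b , c) = from e d in (a , b) , c)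

module _ (I : Interp) where
  open Interp I
  open Sem I

  ⋁R-map : ∀ Π {A B : Rule → Set} → (∀ R → A R → B R) → ⋁R Π A → ⋁R Π B
  ⋁R-map []       f ()
  ⋁R-map (R ∷ Rs) f = ∨c-map (f R) (⋁R-map Rs f)

  module _ (v : Version) (p : Pred) (X : Vec G (ar p)) (ρ : Env) where

    τBody×PosOrd⇔τBody< : ∀ bs →
      (τBody ρ bs × PosOrd v (posAtoms bs) p X ρ) ⇔ τBody< v p X ρ bs
    τBody×PosOrd⇔τBody< [] = mk⇔ (λ _ → tt) (λ _ → tt , tt)
    τBody×PosOrd⇔τBody< (lit pos (q ⦅ ts ⦆) ∷ bs) = mk⇔
        (λ ((_ , b) , o , os) → o , to ih (b , os))
        (λ (o , r) → let (b , os) = from ih r in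
                     (∃c-map (λ _ (vs , a , _) → vs , a) o , b) , o , os)
      where ih = τBody×PosOrd⇔τBody< bs
    τBody×PosOrd⇔τBody< (lit not1 _ ∷ bs) = ×-assocʳ-cong (τBody×PosOrd⇔τBody< bs)
    τBody×PosOrd⇔τBody< (lit not2 _ ∷ bs) = ×-assocʳ-cong (τBody×PosOrd⇔τBody< bs)
    τBody×PosOrd⇔τBody< (cmp _ _ _ ∷ bs) = ×-assocʳ-cong (τBody×PosOrd⇔τBody< bs)

    formWith-×-cong : ∀ {B B' : Env → Set} {C : Set} h → (B ρ × C) ⇔ B' ρ →
      (formWith B h p X ρ × C) ⇔ formWith B' h p X ρ
    formWith-×-cong (basic (q ⦅ ts ⦆)) e with q ≟P p
    ... | yes refl = ×-assocʳ-cong e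
    ... | no _     = mk⇔ proj₁ ⊥-elim
    formWith-×-cong (choice (q ⦅ ts ⦆)) e with q ≟P p
    ... | yes refl = mk⇔ (λ ((vs , b , ¬¬pX) , c) → vs , to e (b , c) , ¬¬pX)
                         (λ (vs , b' , ¬¬pX) → let (b , c) = from e b' in (vs , b , ¬¬pX) , c)
    ... | no _     = mk⇔ proj₁ ⊥-elim
    formWith-×-cong empty e = mk⇔ proj₁ ⊥-elim

    Form×PosOrd⇔OForm : ∀ R →
      (Form R p X ρ × PosOrd v (posAtoms (body R)) p X ρ) ⇔ OForm v R p X ρ
    Form×PosOrd⇔OForm (h ⟵ bs) = formWith-×-cong h (τBody×PosOrd⇔τBody< bs)

  OComp→⇔OComps→ : ∀ v Π p → OComp→ v Π p ⇔ OComps→ v Π p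
  OComp→⇔OComps→ v Π p = mk⇔
    (λ comp X pX → ⋁R-map Π (λ R → ∃c-map λ ρ → to   (Form×PosOrd⇔OForm v p X ρ R)) (comp X pX))
    (λ comp X pX → ⋁R-map Π (λ R → ∃c-map λ ρ → from (Form×PosOrd⇔OForm v p X ρ R)) (comp X pX))

mainTheorem5 : (v : Version) (Π : Program) (I : Interp) →
    Sem.OC I v Π ⇔ Sem.OCs I v Π
mainTheorem5 v Π I = mk⇔
  (map₂ (map₂ λ comps p p∈𝓛 → map₂ (to   (OComp→⇔OComps→ I v Π p)) (comps p p∈𝓛)))
  (map₂ (map₂ λ comps p p∈𝓛 → map₂ (from (OComp→⇔OComps→ I v Π p)) (comps p p∈𝓛)))
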